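{- Let $(G,\prec)$ be a Nyldon-like set over $A$ and let $u_1,u_2,\dots,u_m$ be $G$-words (blocks) such that for every finite sequence $a_1,\dots,a_i$ of indices in $\{1,\dots,m\}$ (repetitions and any order allowed), every $G$-factorization of $u_{a_1}u_{a_2}\cdots u_{a_i}$ preserves the blocks $u_{a_1},\dots,u_{a_i}$. Let $u_k$ be a $\prec$-smallest element among $u_1,\dots,u_m$. Then for every nonempty sequence $a_1,\dots,a_i$ of indices in $\{1,\dots,m\}$, the word $u_ku_{a_1}u_{a_2}\cdots u_{a_i}$ is not in $G$, and every $G$-factorization of $u_ku_{a_1}u_{a_2}\cdots u_{a_i}$ begins with the factor $u_k$.
   Context: $A$ is a finite alphabet with at least two letters. For $w\in A^+$, a $G$-factorization of $w$ is a sequence $(w_1,\dots,w_k)$, $k\ge 1$, of words of $G$ with $w=w_1w_2\cdots w_k$ and $w_1\preceq w_2\preceq\cdots\preceq w_k$. A Nyldon-like set is a pair $(G,\prec)$ with $G\subseteq A^+$ and $\prec$ a total order on $G$ such that: every letter of $A$ lies in $G$; a word $w$ of length at least $2$ lies in $G$ if and only if $w$ has no $G$-factorization with $k\ge 2$ factors; and for all $f,g\in G$ with $fg\in G$ we have $f\prec fg$. Elements of $G$ are called $G$-words. If $w=v_1v_2\cdots v_r$ is viewed as a concatenation of blocks $v_1,\dots,v_r$ (at fixed positions), a factorization $(n_1,\dots,n_s)$ of $w$ preserves the blocks if each $n_i$ is a concatenation of consecutive blocks, i.e. no factor starts or ends strictly inside a block. -}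

module Defs where

open import Level using (Level; 0ℓ; suc)
open import Data.Nat using (ℕ; _≤_; _≥_)
open import Data.Fin using (Fin)
open import Data.List using (List; []; _∷_; _++_; concat; map; length)
open import Data.Product using (Σ; _×_; _,_; ∃; ∃-syntax)
open import Data.Sum using (_⊎_)
open import Data.Empty using (⊥)
open import Relation.Nullary using (¬_)
open import Relation.Binary.PropositionalEquality using (_≡_)

Word : ℕ → Set
Word n = List (Fin n)

NonEmpty : {X : Set} → List X → Set
NonEmpty xs = 1 ≤ length xs

module _ {n : ℕ} (G : Word n → Set) (_≺_ : Word n → Word n → Set) where

  _⪯_ : Word n → Word n → Set
  x ⪯ y = (x ≺ y) ⊎ (x ≡ y)

  data Sorted : List (Word n) → Set where
    []  : Sorted []
    [_] : ∀ x → Sorted (x ∷ [])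
    _∷_ : ∀ {x y ws} → x ⪯ y → Sorted (y ∷ ws) → Sorted (x ∷ y ∷ ws)

  data AllG : List (Word n) → Set where
    []  : AllG []
    _∷_ : ∀ {x ws} → G x → AllG ws → AllG (x ∷ ws)

  record GFactorization (w : Word n) (fs : List (Word n)) : Set where
    field
      nonempty : 1 ≤ length fs
      inG      : AllG fs
      product  : concat fs ≡ w
      sorted   : Sorted fs

  record NyldonLike : Set where
    field
      G-nonempty    : ∀ w → G w → NonEmpty w
      ≺-irrefl      : ∀ x → G x → ¬ (x ≺ x)
      ≺-trans       : ∀ x y z → G x → G y → G z → x ≺ y → y ≺ z → x ≺ z
      ≺-total       : ∀ x y → G x → G y → (x ≺ y) ⊎ (x ≡ y) ⊎ (y ≺ x)
      letters       : ∀ (a : Fin n) → G (a ∷ [])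
      G-char₁       : ∀ w → 2 ≤ length w → G w →
                        ∀ fs → GFactorization w fs → ¬ (2 ≤ length fs)
      G-char₂       : ∀ w → 2 ≤ length w →
                        (∀ fs → GFactorization w fs → ¬ (2 ≤ length fs)) → G w
      prefix-≺      : ∀ f g → G f → G g → G (f ++ g) → f ≺ (f ++ g)

-- Grouping ns vs : the factorization ns of concat vs preserves the blocks vs,
-- i.e. each factor nᵢ is the concatenation of a nonempty run of consecutive blocks.
data PreservesBlocks {n : ℕ} : List (Word n) → List (Word n) → Set where
  []   : PreservesBlocks [] []
  cons : ∀ (grp rest ns : List (Word n)) → NonEmpty grp →
         PreservesBlocks ns rest → PreservesBlocks (concat grp ∷ ns) (grp ++ rest)

module Submission where

-- The heart of the matter is that a proper G-suffix y of a G-word h = z y is smaller than h.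
-- This goes by induction on |h|, then on |z|, jointly with the fact that every G-suffix of a
-- word is a suffix of the last factor of each of its G-factorizations.  Factor z.  If z is a
-- single factor, then y ≺ z ≺ z y, or z ⪯ y and (z, y) factorizes h.  Otherwise let zt be the
-- last factor of z and factor zt y: its last factor ℓ ends with y.  If ℓ = y, the factors of z
-- followed by y factorize h; otherwise y ≺ ℓ ≺ h by the two induction hypotheses.
-- Hence a G-word that is a product of blocks is ≽ its last block, so ≽ u_k.  A G-factorization
-- of u_{a_1}⋯u_{a_i} starts with such a product, so prepending u_k gives a G-factorization of
-- u_k u_{a_1}⋯u_{a_i} with at least two factors; and in a G-factorization of the latter the
-- first factor is u_k followed by blocks, which by the first part must be none.
-- Membership in G is undecidable, so G-factorizations exist only up to double negation; this
-- suffices because every conclusion is negative or, like y ≺ h, stable by trichotomy.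

open import Defs
open import Data.Nat using (ℕ; zero; suc; _≤_; _<_; z≤n; s≤s)
open import Data.Nat.Properties using (≤-refl; ≤-trans; ≤-reflexive; ≤-pred; <-≤-trans; <-irrefl)
open import Data.Fin using (Fin)
open import Data.List using (List; []; _∷_; _++_; _∷ʳ_; concat; map; length; _∷ʳ′_; initLast)
open import Data.List.Properties
  using (++-assoc; ++-identityʳ; ++-cancelʳ; concat-++; length-map; length-++-≤ˡ; length-++-≤ʳ; ∷-injective)
open import Data.List.Relation.Unary.All using (All; _∷_; universal)
import Data.List.Relation.Unary.All as All
open import Data.List.Relation.Unary.All.Properties using (++⁻ˡ; ∷ʳ⁻; map⁺)
open import Data.Product using (Σ; _×_; _,_; proj₁; proj₂; ∃; ∃₂)
import Data.Product as Product
open import Data.Sum using (_⊎_; inj₁; inj₂)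
open import Data.Empty using (⊥; ⊥-elim)
open import Relation.Nullary using (¬_)
open import Relation.Nullary.Negation using (Stable)
open import Function using (_∘_)
open import Relation.Binary.PropositionalEquality
  using (_≡_; refl; sym; trans; cong; cong₂; subst; module ≡-Reasoning)

private
  variable
    A B : Set
    y : A
    xs ys : List A

NonEmpty-++ˡ : ∀ (xs : List A) → NonEmpty xs → NonEmpty (xs ++ ys)
NonEmpty-++ˡ (_ ∷ _) _ = s≤s z≤n

NonEmpty-++ʳ : ∀ (xs : List A) → NonEmpty (xs ++ y ∷ ys)
NonEmpty-++ʳ []      = s≤s z≤n
NonEmpty-++ʳ (_ ∷ _) = s≤s z≤n

length-++-<ˡ : ∀ (xs ys : List A) → NonEmpty ys → length xs < length (xs ++ ys)
length-++-<ˡ []       _  ne = ne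
length-++-<ˡ (_ ∷ xs) ys ne = s≤s (length-++-<ˡ xs ys ne)

length-++-<ʳ : ∀ (xs ys : List A) → NonEmpty xs → length ys < length (xs ++ ys)
length-++-<ʳ (_ ∷ xs) ys _ = s≤s (length-++-≤ʳ ys {xs})

concat-∷ʳ : ∀ (xss : List (List A)) xs → concat (xss ∷ʳ xs) ≡ concat xss ++ xs
concat-∷ʳ xss xs = trans (sym (concat-++ xss (xs ∷ []))) (cong (concat xss ++_) (++-identityʳ xs))

++-equidivisible : ∀ (a b c d : List A) → a ++ b ≡ c ++ d →
  (∃ λ m → c ≡ a ++ m × b ≡ m ++ d) ⊎ (∃ λ m → a ≡ c ++ m × d ≡ m ++ b)
++-equidivisible []      b c       d eq = inj₁ (c , refl , eq)
++-equidivisible (x ∷ a) b []      d eq = inj₂ (x ∷ a , refl , sym eq)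
++-equidivisible (x ∷ a) b (_ ∷ c) d eq with ∷-injective eq
... | refl , eq′ with ++-equidivisible a b c d eq′
...   | inj₁ (m , c≡a++m , b≡m++d) = inj₁ (m , cong (x ∷_) c≡a++m , b≡m++d)
...   | inj₂ (m , a≡c++m , d≡m++b) = inj₂ (m , cong (x ∷_) a≡c++m , d≡m++b)

prefix-of-map : ∀ (f : A → B) as {ys zs} → ys ++ zs ≡ map f as → ∃ λ bs → ys ≡ map f bs
prefix-of-map f as       {[]}     _  = [] , refl
prefix-of-map f (a ∷ as) {_ ∷ ys} eq with ∷-injective eq
... | refl , eq′ = Product.map (a ∷_) (cong (f a ∷_)) (prefix-of-map f as eq′)

leading-group : ∀ {n} {f : Word n} {fs vs} → PreservesBlocks (f ∷ fs) vs →
  ∃₂ λ grp rest → f ≡ concat grp × grp ++ rest ≡ vs × NonEmpty grp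
leading-group (cons grp rest _ ne _) = grp , rest , refl , refl , ne

module NyldonLikeProperties {n : ℕ} {G : Word n → Set} {_≺_ : Word n → Word n → Set}
                            (N : NyldonLike G _≺_) where
  open NyldonLike N

  private
    variable
      b f p q u v w z : Word n
      fs ps qs vs : List (Word n)

    infix 4 _≼_
    _≼_ : Word n → Word n → Set
    _≼_ = _⪯_ G _≺_

    Chain : List (Word n) → Set
    Chain = Sorted G _≺_

    AllG′ : List (Word n) → Set
    AllG′ = AllG G _≺_

    Factorization : Word n → List (Word n) → Set
    Factorization = GFactorization G _≺_

  ≺-stable : G u → G v → Stable (u ≺ v)
  ≺-stable {u} {v} gu gv ¬¬u≺v with ≺-total u v gu gv
  ... | inj₁ u≺v         = u≺v
  ... | inj₂ (inj₁ refl) = ⊥-elim (¬¬u≺v (≺-irrefl u gu))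
  ... | inj₂ (inj₂ v≺u)  = ⊥-elim (¬¬u≺v λ u≺v → ≺-irrefl u gu (≺-trans u v u gu gv gu u≺v v≺u))

  ≺-or-≽ : G u → G v → u ≺ v ⊎ v ≼ u
  ≺-or-≽ {u} {v} gu gv with ≺-total u v gu gv
  ... | inj₁ u≺v         = inj₁ u≺v
  ... | inj₂ (inj₁ refl) = inj₂ (inj₂ refl)
  ... | inj₂ (inj₂ v≺u)  = inj₂ (inj₁ v≺u)

  ≼-≺-trans : G u → G v → G w → u ≼ v → v ≺ w → u ≺ w
  ≼-≺-trans gu gv gw (inj₁ u≺v) v≺w = ≺-trans _ _ _ gu gv gw u≺v v≺w
  ≼-≺-trans _  _  _  (inj₂ refl) v≺w = v≺w

  ≼-trans : G u → G v → G w → u ≼ v → v ≼ w → u ≼ w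
  ≼-trans gu gv gw u≼v (inj₁ v≺w)  = inj₁ (≼-≺-trans gu gv gw u≼v v≺w)
  ≼-trans _  _  _  u≼v (inj₂ refl) = u≼v

  Chain-∷ʳ⁻ : ∀ ps → Chain (ps ∷ʳ p) → Chain ps
  Chain-∷ʳ⁻ []           _         = []
  Chain-∷ʳ⁻ (q ∷ [])     _         = [ q ]
  Chain-∷ʳ⁻ (_ ∷ _ ∷ ps) (q≼ ∷ ch) = q≼ ∷ Chain-∷ʳ⁻ (_ ∷ ps) ch

  Chain-tail : Chain (f ∷ fs) → Chain fs
  Chain-tail [ _ ]    = []
  Chain-tail (_ ∷ ch) = ch

  Chain-join : ∀ ps → Chain (ps ∷ʳ p) → Chain (p ∷ vs) → Chain (ps ++ p ∷ vs)
  Chain-join []           _          ch = ch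
  Chain-join (_ ∷ [])     (q≼ ∷ _)   ch = q≼ ∷ ch
  Chain-join (_ ∷ _ ∷ ps) (q≼ ∷ ch′) ch = q≼ ∷ Chain-join (_ ∷ ps) ch′ ch

  Chain-lowerHead : G q → AllG′ (f ∷ fs) → q ≼ f → Chain (f ∷ fs) → Chain (q ∷ fs)
  Chain-lowerHead _  _             _   [ _ ]      = [ _ ]
  Chain-lowerHead gq (gf ∷ gg ∷ _) q≼f (f≼g ∷ ch) = ≼-trans gq gf gg q≼f f≼g ∷ ch

  AllG-++ : AllG′ fs → AllG′ vs → AllG′ (fs ++ vs)
  AllG-++ []         gvs = gvs
  AllG-++ (gf ∷ gfs) gvs = gf ∷ AllG-++ gfs gvs

  AllG-∷ʳ⁻ : ∀ ps → AllG′ (ps ∷ʳ p) → AllG′ ps × G p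
  AllG-∷ʳ⁻ []       (gp ∷ _)   = [] , gp
  AllG-∷ʳ⁻ (_ ∷ ps) (gq ∷ gps) = Product.map₁ (gq ∷_) (AllG-∷ʳ⁻ ps gps)

  factorization-nonempty : Factorization w fs → NonEmpty w
  factorization-nonempty {fs = f ∷ _} record { inG = gf ∷ _ ; product = refl } =
    NonEmpty-++ˡ f (G-nonempty f gf)

  head-G : Factorization w (f ∷ fs) → G f
  head-G record { inG = gf ∷ _ } = gf

  factorization-∷ʳ⁻ : ∀ ps → Factorization w (ps ∷ʳ p) → w ≡ concat ps ++ p × G p
  factorization-∷ʳ⁻ {p = p} ps fact =
    trans (sym (GFactorization.product fact)) (concat-∷ʳ ps p) ,
    proj₂ (AllG-∷ʳ⁻ ps (GFactorization.inG fact))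

  factorization-init : ∀ ps → Factorization w (ps ∷ʳ p) → NonEmpty ps → Factorization (concat ps) ps
  factorization-init ps fact ne = record
    { nonempty = ne
    ; inG      = proj₁ (AllG-∷ʳ⁻ ps (GFactorization.inG fact))
    ; product  = refl
    ; sorted   = Chain-∷ʳ⁻ ps (GFactorization.sorted fact)
    }

  factorization-tail : Factorization w (f ∷ fs) → NonEmpty fs → Factorization (concat fs) fs
  factorization-tail record { inG = _ ∷ gfs ; sorted = ch } ne = record
    { nonempty = ne ; inG = gfs ; product = refl ; sorted = Chain-tail ch }

  singleton-factorization : G w → Factorization w (w ∷ [])
  singleton-factorization {w} gw = record
    { nonempty = s≤s z≤n ; inG = gw ∷ [] ; product = ++-identityʳ w ; sorted = [ w ] }

  factorization-++ : ∀ ps → Factorization u (ps ∷ʳ p) → Factorization v vs → Chain (p ∷ vs) →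
                     Factorization (u ++ v) (ps ++ p ∷ vs)
  factorization-++ {u} {p} {v} {vs} ps fu fv ch = record
    { nonempty = NonEmpty-++ʳ ps
    ; inG      = AllG-++ gps (gp ∷ GFactorization.inG fv)
    ; product  = begin
        concat (ps ++ p ∷ vs)         ≡⟨ concat-++ ps (p ∷ vs) ⟨
        concat ps ++ p ++ concat vs   ≡⟨ ++-assoc (concat ps) p (concat vs) ⟨
        (concat ps ++ p) ++ concat vs ≡⟨ cong₂ _++_ (sym u≡) (GFactorization.product fv) ⟩
        u ++ v                        ∎
    ; sorted   = Chain-join ps (GFactorization.sorted fu) ch
    }
    where
    open ≡-Reasoning

    gps : AllG′ ps
    gps = proj₁ (AllG-∷ʳ⁻ ps (GFactorization.inG fu))

    u≡ : u ≡ concat ps ++ p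
    u≡ = proj₁ (factorization-∷ʳ⁻ ps fu)

    gp : G p
    gp = proj₂ (factorization-∷ʳ⁻ ps fu)

  factorization-length : Factorization w (f ∷ q ∷ fs) → 2 ≤ length w
  factorization-length {f = f} {q} {fs} record { inG = gf ∷ gq ∷ _ ; product = refl } =
    ≤-trans (s≤s (NonEmpty-++ˡ q (G-nonempty q gq))) (length-++-<ʳ f (q ++ concat fs) (G-nonempty f gf))

  G-unfactorizable : G w → Factorization w (f ∷ fs) → ¬ NonEmpty fs
  G-unfactorizable {w} {fs = _ ∷ _} gw fact _ =
    G-char₁ w (factorization-length fact) gw _ fact (s≤s (s≤s z≤n))

  G-factorization-unique : G w → Factorization w fs → fs ≡ w ∷ []
  G-factorization-unique {fs = f ∷ []} _ fact =
    cong (_∷ []) (trans (sym (++-identityʳ f)) (GFactorization.product fact))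
  G-factorization-unique {fs = _ ∷ _ ∷ _} gw fact = ⊥-elim (G-unfactorizable gw fact (s≤s z≤n))

  G-unsplittable : ∀ ps → G (u ++ v) → Factorization u (ps ∷ʳ p) → Factorization v vs →
                   Chain (p ∷ vs) → ⊥
  G-unsplittable []       guv fu fv ch =
    G-unfactorizable guv (factorization-++ [] fu fv ch) (GFactorization.nonempty fv)
  G-unsplittable (_ ∷ ps) guv fu fv ch =
    G-unfactorizable guv (factorization-++ (_ ∷ ps) fu fv ch) (NonEmpty-++ʳ ps)

  G-init-≼-last : G v → Factorization (v ++ p) (qs ∷ʳ p) → v ≼ p
  G-init-≼-last {v} {p} {[]} gv fact =
    ⊥-elim (<-irrefl refl (subst (λ w → length p < length w) (proj₁ (factorization-∷ʳ⁻ [] fact))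
                                 (length-++-<ʳ v p (G-nonempty v gv))))
  G-init-≼-last {v} {p} {qs@(_ ∷ _)} gv fact
    with G-factorization-unique gv (subst (λ w → Factorization w qs) (sym v≡concat-qs)
                                          (factorization-init qs fact (s≤s z≤n)))
    where
    v≡concat-qs : v ≡ concat qs
    v≡concat-qs = ++-cancelʳ p v (concat qs) (proj₁ (factorization-∷ʳ⁻ qs fact))
  ... | refl with GFactorization.sorted fact
  ...   | v≼p ∷ _ = v≼p

  no-factorization⇒G : NonEmpty w → ¬ ∃ (Factorization w) → G w
  no-factorization⇒G {a ∷ []}    _ _      = letters a
  no-factorization⇒G {_ ∷ _ ∷ _} _ ¬fact = G-char₂ _ (s≤s (s≤s z≤n)) λ fs fact _ → ¬fact (fs , fact)

  ¬¬-factorization : NonEmpty w → ¬ ¬ ∃ (Factorization w)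
  ¬¬-factorization {w} ne ¬fact = ¬fact (w ∷ [] , singleton-factorization (no-factorization⇒G ne ¬fact))

  factorization-∷ʳ-view : Factorization w fs → ∃₂ λ ps p → Factorization w (ps ∷ʳ p)
  factorization-∷ʳ-view {fs = fs} fact with initLast fs
  ... | []       = ⊥-elim (empty fact)
    where
    empty : ¬ Factorization w []
    empty record { nonempty = () }
  ... | ps ∷ʳ′ p = ps , p , fact

  ¬¬-factorization-∷ʳ : NonEmpty w → ¬ ¬ (∃₂ λ ps p → Factorization w (ps ∷ʳ p))
  ¬¬-factorization-∷ʳ ne ¬fact = ¬¬-factorization ne λ (_ , fact) → ¬fact (factorization-∷ʳ-view fact)

  SuffixSmaller : ℕ → ℕ → Set
  SuffixSmaller F M = ∀ {h z y} → h ≡ z ++ y → length h ≤ F → length z ≤ M →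
                      NonEmpty z → G h → G y → y ≺ h

  LastFactorLongest : ℕ → Set
  LastFactorLongest F = ∀ {w ps p x s} → length w ≤ F → Factorization w (ps ∷ʳ p) →
                        w ≡ x ++ s → G s → ∃ λ c → p ≡ c ++ s

  suffix-factorization-≼ : ∀ {F} → (∀ M → SuffixSmaller F M) → ∀ x {m} → length (x ++ m) ≤ F →
    NonEmpty m → G (x ++ m) → ¬ ¬ (∃₂ λ qs q → Factorization m (qs ∷ʳ q) × q ≼ x ++ m)
  suffix-factorization-≼ _ [] _ _ gm k = k ([] , _ , singleton-factorization gm , inj₂ refl)
  suffix-factorization-≼ ih x@(_ ∷ _) lf nm gf k = ¬¬-factorization-∷ʳ nm λ (qs , q , fm) →
    let m≡qs++q , gq = factorization-∷ʳ⁻ qs fm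
        split-f = trans (cong (x ++_) m≡qs++q) (sym (++-assoc x (concat qs) q))
    in k (qs , q , fm , inj₁ (ih _ split-f lf ≤-refl (s≤s z≤n) gf gq))

  last-factor-longest : ∀ {F} → (∀ M → SuffixSmaller F M) → LastFactorLongest F
  last-factor-longest {F} ih {ps = ps} = go ps
    where
    go : ∀ ps {w p x s} → length w ≤ F → Factorization w (ps ∷ʳ p) → w ≡ x ++ s → G s → ∃ λ c → p ≡ c ++ s
    go [] {x = x} _ fact w≡x++s _ = x , trans (sym (proj₁ (factorization-∷ʳ⁻ [] fact))) w≡x++s
    go (f ∷ ps) {p = p} {x} {s} lw fact eq gs with GFactorization.product fact
    ... | refl with ++-equidivisible f (concat (ps ∷ʳ p)) x s eq
    ...   | inj₁ (m , refl , rest≡m++s) =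
      go ps (≤-trans (length-++-≤ʳ _ {f}) lw) (factorization-tail fact (NonEmpty-++ʳ ps)) rest≡m++s gs
    ...   | inj₂ ([] , refl , refl) =
      go ps (≤-trans (length-++-≤ʳ _ {f}) lw) (factorization-tail fact (NonEmpty-++ʳ ps)) refl gs
    ...   | inj₂ (m@(_ ∷ _) , refl , refl) = ⊥-elim
      (suffix-factorization-≼ ih x (≤-trans (length-++-≤ˡ (x ++ m)) lw) (s≤s z≤n) (head-G fact)
        λ (qs , q , fm , q≼f) → G-unsplittable qs gs fm (factorization-tail fact (NonEmpty-++ʳ ps))
          (Chain-lowerHead (proj₂ (factorization-∷ʳ⁻ qs fm)) (GFactorization.inG fact) q≼f
                           (GFactorization.sorted fact)))

  suffix-≺-step : ∀ {F M} → (∀ M → SuffixSmaller F M) → LastFactorLongest F →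
                  SuffixSmaller (suc F) M → SuffixSmaller (suc F) (suc M)
  suffix-≺-step {F} ih last-longest ih-z {z = z} {y} refl lh lz nz gh gy =
    ≺-stable gy gh λ y⊀h → ¬¬-factorization-∷ʳ nz λ (ps , _ , fact) → refute y⊀h ps fact
    where
    open ≡-Reasoning

    refute : ¬ (y ≺ (z ++ y)) → ∀ ps {zt} → Factorization z (ps ∷ʳ zt) → ⊥
    refute y⊀h [] fact with factorization-∷ʳ⁻ [] fact
    ... | refl , gz with ≺-or-≽ gy gz
    ...   | inj₁ y≺z = y⊀h (≺-trans _ _ _ gy gz gh y≺z (prefix-≺ z y gz gy gh))
    ...   | inj₂ z≼y = G-unsplittable [] gh fact (singleton-factorization gy) (z≼y ∷ [ y ])
    refute y⊀h (f ∷ ps) {zt} fact =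
      ¬¬-factorization-∷ʳ (NonEmpty-++ˡ zt (G-nonempty zt gzt)) λ (qs , _ , fact′) → compare qs fact′
      where
      pre : Word n
      pre = concat (f ∷ ps)

      z≡pre++zt : z ≡ pre ++ zt
      z≡pre++zt = proj₁ (factorization-∷ʳ⁻ (f ∷ ps) fact)

      gzt : G zt
      gzt = proj₂ (factorization-∷ʳ⁻ (f ∷ ps) fact)

      npre : NonEmpty pre
      npre = factorization-nonempty (factorization-init (f ∷ ps) fact (s≤s z≤n))

      h≡pre++zty : z ++ y ≡ pre ++ (zt ++ y)
      h≡pre++zty = trans (cong (_++ y) z≡pre++zt) (++-assoc pre zt y)

      lzty : length (zt ++ y) ≤ F
      lzty = ≤-pred (<-≤-trans (length-++-<ʳ pre (zt ++ y) npre)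
                               (≤-trans (≤-reflexive (cong length (sym h≡pre++zty))) lh))

      compare : ∀ qs {ℓ} → Factorization (zt ++ y) (qs ∷ʳ ℓ) → ⊥
      compare qs fact′ with last-longest lzty fact′ refl gy
      ... | [] , refl = G-unsplittable (f ∷ ps) gh fact (singleton-factorization gy)
                          (G-init-≼-last gzt fact′ ∷ [ y ])
      ... | c@(_ ∷ _) , refl = y⊀h (≺-trans _ _ _ gy gℓ gh y≺ℓ ℓ≺h)
        where
        z′ : Word n
        z′ = pre ++ concat qs

        zty≡ : zt ++ y ≡ concat qs ++ (c ++ y)
        zty≡ = proj₁ (factorization-∷ʳ⁻ qs fact′)

        gℓ : G (c ++ y)
        gℓ = proj₂ (factorization-∷ʳ⁻ qs fact′)

        h≡z′++ℓ : z ++ y ≡ z′ ++ (c ++ y)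
        h≡z′++ℓ = begin
          z ++ y                          ≡⟨ h≡pre++zty ⟩
          pre ++ (zt ++ y)                ≡⟨ cong (pre ++_) zty≡ ⟩
          pre ++ (concat qs ++ (c ++ y))  ≡⟨ ++-assoc pre (concat qs) (c ++ y) ⟨
          z′ ++ (c ++ y)                  ∎

        z≡z′++c : z ≡ z′ ++ c
        z≡z′++c = ++-cancelʳ y z (z′ ++ c) (trans h≡z′++ℓ (sym (++-assoc z′ c y)))

        y≺ℓ : y ≺ (c ++ y)
        y≺ℓ = ih _ refl (≤-trans (length-++-≤ʳ (c ++ y) {concat qs})
                                 (≤-trans (≤-reflexive (cong length (sym zty≡))) lzty))
                 ≤-refl (s≤s z≤n) gℓ gy

        ℓ≺h : (c ++ y) ≺ (z ++ y)
        ℓ≺h = ih-z h≡z′++ℓ lh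
                (≤-pred (<-≤-trans (length-++-<ˡ z′ c (s≤s z≤n))
                                   (≤-trans (≤-reflexive (cong length (sym z≡z′++c))) lz)))
                (NonEmpty-++ˡ pre npre) gh gℓ

  suffix-≺-bounded : ∀ F M → SuffixSmaller F M
  suffix-≺-bounded _       _       {z = []}    _    _  _  () _ _
  suffix-≺-bounded zero    _       {z = _ ∷ _} refl () _  _  _ _
  suffix-≺-bounded (suc F) zero    {z = _ ∷ _} _    _  () _  _ _
  suffix-≺-bounded (suc F) (suc M) =
    suffix-≺-step (suffix-≺-bounded F) (last-factor-longest (suffix-≺-bounded F)) (suffix-≺-bounded (suc F) M)

  suffix-≺ : u ≡ z ++ v → NonEmpty z → G u → G v → v ≺ u
  suffix-≺ u≡z++v = suffix-≺-bounded _ _ u≡z++v ≤-refl ≤-refl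

  ≼-concat : G b → All G vs → All (b ≼_) vs → NonEmpty vs → G (concat vs) → b ≼ concat vs
  ≼-concat {vs = vs} gb gvs b≼vs nvs gcvs with initLast vs
  ≼-concat gb gvs b≼vs () gcvs | []
  ≼-concat gb gvs b≼vs nvs gcvs | [] ∷ʳ′ v = subst (_ ≼_) (sym (++-identityʳ v)) (All.head b≼vs)
  ≼-concat gb gvs b≼vs nvs gcvs | vs′@(v′ ∷ _) ∷ʳ′ v =
    inj₁ (≼-≺-trans gb gv gcvs (proj₂ (∷ʳ⁻ {xs = vs′} b≼vs))
            (suffix-≺ (concat-∷ʳ vs′ v) (NonEmpty-++ˡ v′ (G-nonempty v′ (All.head gvs))) gcvs gv))
    where
    gv : G v
    gv = proj₂ (∷ʳ⁻ {xs = vs′} gvs)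

  blocks-extension-∉G : G b → All G vs → All (b ≼_) vs → NonEmpty vs →
    (∀ fs → Factorization (concat vs) fs → PreservesBlocks fs vs) → ¬ G (b ++ concat vs)
  blocks-extension-∉G {b} {vs} gb gvs b≼vs nvs preserves gbvs =
    ¬¬-factorization (nonempty-concat gvs nvs) λ (fs , fact) → refute fs fact
    where
    nonempty-concat : ∀ {vs} → All G vs → NonEmpty vs → NonEmpty (concat vs)
    nonempty-concat {v ∷ _} (gv ∷ _) _ = NonEmpty-++ˡ v (G-nonempty v gv)

    refute : ∀ fs → Factorization (concat vs) fs → ⊥
    refute (f ∷ fs) fact with leading-group (preserves _ fact)
    ... | grp , _ , refl , grp++rest≡vs , ngrp =
      G-unsplittable [] gbvs (singleton-factorization gb) fact (b≼grp ∷ GFactorization.sorted fact)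
      where
      prefix : ∀ {P : Word n → Set} → All P vs → All P grp
      prefix = ++⁻ˡ grp ∘ subst (All _) (sym grp++rest≡vs)

      b≼grp : b ≼ concat grp
      b≼grp = ≼-concat gb (prefix gvs) (prefix b≼vs) ngrp (head-G fact)

  factorization-starts-with : (∀ fs → Factorization (b ++ concat vs) fs → PreservesBlocks fs (b ∷ vs)) →
    (∀ grp rest → grp ++ rest ≡ vs → NonEmpty grp → ¬ G (b ++ concat grp)) →
    Factorization (b ++ concat vs) fs → ∃ λ rest → fs ≡ b ∷ rest
  factorization-starts-with {fs = f ∷ fs} preserves prefix-∉G fact with leading-group (preserves _ fact)
  ... | g ∷ grp , rest , refl , eq , _ with ∷-injective eq
  ...   | refl , grp++rest≡vs with grp
  ...     | []        = fs , cong (_∷ fs) (++-identityʳ g)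
  ...     | grp@(_ ∷ _) = ⊥-elim (prefix-∉G grp rest grp++rest≡vs (s≤s z≤n) (head-G fact))

corollary3p4 : {n : ℕ} → 2 ≤ n →
    (G : Word n → Set) (_≺_ : Word n → Word n → Set) → NyldonLike G _≺_ →
    (m : ℕ) (u : Fin m → Word n) → (∀ j → G (u j)) →
    (∀ (as : List (Fin m)) (fs : List (Word n)) →
      GFactorization G _≺_ (concat (map u as)) fs → PreservesBlocks fs (map u as)) →
    (k : Fin m) → (∀ j → _⪯_ G _≺_ (u k) (u j)) →
    ∀ (as : List (Fin m)) → 1 ≤ length as →
      ¬ G (u k ++ concat (map u as))
      × (∀ (fs : List (Word n)) → GFactorization G _≺_ (u k ++ concat (map u as)) fs →
           Σ (List (Word n)) λ rest → fs ≡ u k ∷ rest)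
corollary3p4 _ G _≺_ N m u gu preserves k minimal as nas =
  blocks-∉G as (subst (1 ≤_) (sym (length-map u as)) nas) ,
  λ fs → factorization-starts-with (preserves (k ∷ as)) prefix-∉G
  where
  open NyldonLikeProperties N

  blocks-∉G : ∀ as → NonEmpty (map u as) → ¬ G (u k ++ concat (map u as))
  blocks-∉G as nvs = blocks-extension-∉G (gu k) (map⁺ (universal gu as)) (map⁺ (universal minimal as))
                       nvs (preserves as)

  prefix-∉G : ∀ grp rest → grp ++ rest ≡ map u as → NonEmpty grp → ¬ G (u k ++ concat grp)
  prefix-∉G grp rest eq with prefix-of-map u as {grp} eq
  ... | bs , refl = blocks-∉G bs
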